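{- Let $\mathcal{M}=(Q,\Gamma,\Delta,q_0,\gamma_0)$ be a DCFS, $k\in\mathbb{N}$ and $F\subseteq Q$. For $i\in[0,k]$ let $\Sigma_i=(\Gamma_\epsilon\times\{i+1\}\times\{\rhd\})\cup(\Gamma\times\{i\}\times\{\lhd\})\cup\{(\epsilon,i,-)\}$ and $\Sigma=\bigcup_{i=0}^k\Sigma_i$. Let $\mathcal{P}$ be the pushdown automaton with states $Q$, input alphabet $\Sigma$, stack alphabet $(\Gamma_\epsilon\times[0,k])\cup\{\bot\}$, initial state $q_0$, initial stack symbol $\bot$, final states $F$, and the smallest transition relation such that for every $i\in[0,k]$: if $\langle q,\gamma\rangle\to\langle q',u\rangle\rhd\epsilon\in\Delta$ then $\langle q,(\gamma,i)\rangle\xrightarrow{(\epsilon,i,-)}\langle q',(u,i)\rangle$; if $\langle q,\gamma\rangle\to\langle q',u\rangle\rhd\alpha\in\Delta$ with $\alpha\in\Gamma$ then $\langle q,(\gamma,i)\rangle\xrightarrow{(\alpha,i+1,\rhd)}\langle q',(u,i)\rangle$; if $\langle q,\gamma\rangle\mapsto\langle q',u\rangle\in\Delta$ then $\langle q,(\gamma,i)\rangle\xrightarrow{(u,i+1,\rhd)}\langle q',\bot\rangle$; if $q\mapsto q'\lhd\gamma\in\Delta$ then $\langle q,\bot\rangle\xrightarrow{(\gamma,i,\lhd)}\langle q',(\gamma,i)\rangle$ (where $(u,i)$ with $u\in\Gamma_\epsilon$ is a single stack symbol). Then some state in $F$ is $k$-stratified reachable by $\mathcal{M}$ if and only if there are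 words $\sigma_i\in\Sigma_i^*$ for $i\in[0,k]$ such that (1) $\sigma_0\sigma_1\cdots\sigma_k$ labels a run of $\mathcal{P}$ from configuration $(q_0,\bot)$ to some configuration $(q_f,\bot)$ with $q_f\in F$, and (2) $|\sigma_i|_{(\gamma,i,\lhd)}\le|\sigma_{i-1}|_{(\gamma,i,\rhd)}$ for all $\gamma\in\Gamma$ and $i\in[0,k]$, where $\sigma_{ -1}=(\gamma_0,0,\rhd)$ and $|\sigma|_a$ is the number of occurrences of $a$ in $\sigma$.
   Context: A DCPS is a tuple $(Q,\Gamma,\Delta,q_0,\gamma_0)$: $Q$ finite non-empty set of states, $\Gamma$ finite stack alphabet, $q_0\in Q$, $\gamma_0\in\Gamma$, $\Delta$ consisting of creation rules $\langle q,\gamma\rangle\to\langle q',u\rangle\rhd\alpha$ ($u\in\Gamma^{\le 2}=\Gamma_\epsilon\cup\Gamma^2$, $\alpha\in\Gamma_\epsilon=\Gamma\cup\{\epsilon\}$), interruption rules $\langle q,\gamma\rangle\mapsto\langle q',u\rangle$, and resumption rules $q\mapsto q'\lhd\gamma$. A DCFS is a DCPS in which every creation and interruption rule has $|u|\le 1$. Local configurations are $(w,i)\in\Gamma^*\times\mathbb{N}$ (set $\mathit{Loc}$); configurations are $(q,\eta,\mathit{Val})$ with $q\in Q$, $\eta\in\mathit{Loc}\cup\{\bot\}$, $\mathit{Val}:\mathit{Loc}\to\mathbb{N}$; $\mathbf{1}_x$ maps $x$ to $1$, all else to $0$. Initial configuration $(q_0,\bot,\mathbf{1}_{(\gamma_0,0)})$.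 Steps: creation $(q,(\gamma w,i),\mathit{Val})\to(q',(uw,i),\mathit{Val}')$ with $\mathit{Val}'=\mathit{Val}+\mathbf{1}_{(\alpha,i+1)}$ if $\alpha\in\Gamma$, else $\mathit{Val}'=\mathit{Val}$; interruption $(q,(\gamma w,i),\mathit{Val})\to(q',\bot,\mathit{Val}+\mathbf{1}_{(uw,i+1)})$; resumption $(q,\bot,\mathit{Val}+\mathbf{1}_{(\gamma w,i)})\to(q',(\gamma w,i),\mathit{Val})$. A step $c\to c'$ is $\{i\}$-bounded if the active thread of $c$ or $c'$ exists and has switch number $i$. A state $q$ is $k$-stratified reachable if there are configurations $c_1,\ldots,c_{k+1}$, with $c_{k+1}$ having state $q$ and no active thread, such that the initial configuration $c_0$ reaches $c_1$ by $\{0\}$-bounded steps and $c_i$ reaches $c_{i+1}$ by $\{i\}$-bounded steps for $i\in[1,k]$. A pushdown automaton transition $\langle p,\gamma\rangle\xrightarrow{a}\langle p',u\rangle$ induces steps $(p,\gamma w)\xrightarrow{a}(p',uw)$ on configurations (state, stack word with top on the left). -}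

module Defs where

open import Data.Nat using (ℕ; zero; suc; _+_; _≤_)
import Data.Nat as ℕ
open import Data.Fin using (Fin)
import Data.Fin as Fin
open import Data.Fin.Subset using (Subset)
open import Data.Maybe using (Maybe; just; nothing; maybe)
import Data.Maybe as Maybe
import Data.Maybe.Properties as MaybeP
open import Data.List using (List; []; _∷_; [_]; _++_; length; filter; concat; map; upTo)
import Data.List.Properties as ListP
open import Data.List.Relation.Unary.All using (All)
open import Data.List.Membership.Propositional using () renaming (_∈_ to _∈ᴸ_)
open import Data.Product using (Σ; ∃; ∃-syntax; _×_; _,_; proj₁; proj₂)
import Data.Product.Properties as ProdP
open import Data.Sum using (_⊎_)
open import Relation.Binary.PropositionalEquality using (_≡_; refl)
open import Relation.Binary.Definitions using (DecidableEquality)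
open import Relation.Nullary using (yes; no)
open import Relation.Binary.Construct.Closure.ReflexiveTransitive using (Star)

-- DCPS / DCFS.  States Q = Fin nQ, stack alphabet Γ = Fin nΓ.
-- Γ_ε is rendered as Maybe Γ (nothing = ε); Γ^{≤2} as List Γ with a
-- length bound (enforced in the record field 'wf').

data Rule (nQ nΓ : ℕ) : Set where
  -- ⟨q,γ⟩ → ⟨q',u⟩ ▷ α
  create    : Fin nQ → Fin nΓ → Fin nQ → List (Fin nΓ) → Maybe (Fin nΓ) → Rule nQ nΓ
  -- ⟨q,γ⟩ ↦ ⟨q',u⟩
  interrupt : Fin nQ → Fin nΓ → Fin nQ → List (Fin nΓ) → Rule nQ nΓ
  -- q ↦ q' ◁ γ
  resume    : Fin nQ → Fin nQ → Fin nΓ → Rule nQ nΓ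

ruleWord : ∀ {nQ nΓ} → Rule nQ nΓ → List (Fin nΓ)
ruleWord (create _ _ _ u _)  = u
ruleWord (interrupt _ _ _ u) = u
ruleWord (resume _ _ _)      = []

record DCPS (nQ nΓ : ℕ) : Set where
  field
    Δ  : List (Rule nQ nΓ)
    q₀ : Fin nQ
    γ₀ : Fin nΓ
    wf : All (λ r → length (ruleWord r) ≤ 2) Δ

open DCPS public

IsDCFS : ∀ {nQ nΓ} → DCPS nQ nΓ → Set
IsDCFS M = All (λ r → length (ruleWord r) ≤ 1) (Δ M)

Loc : ℕ → Set
Loc nΓ = List (Fin nΓ) × ℕ

_≟Loc_ : ∀ {nΓ} → DecidableEquality (Loc nΓ)
_≟Loc_ = ProdP.≡-dec (ListP.≡-dec Fin._≟_) ℕ._≟_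

𝟏 : ∀ {nΓ} → Loc nΓ → Loc nΓ → ℕ
𝟏 x y with x ≟Loc y
... | yes _ = 1
... | no  _ = 0

-- configurations (q, η, Val); η = nothing means ⊥ (no active thread)
Config : ℕ → ℕ → Set
Config nQ nΓ = Fin nQ × Maybe (Loc nΓ) × (Loc nΓ → ℕ)

initConfig : ∀ {nQ nΓ} → DCPS nQ nΓ → Config nQ nΓ
initConfig M = q₀ M , nothing , 𝟏 ([ γ₀ M ] , 0)

spawn : ∀ {nΓ} → Maybe (Fin nΓ) → ℕ → Loc nΓ → ℕ
spawn nothing  i y = 0
spawn (just α) i y = 𝟏 ([ α ] , suc i) y

-- Multisets Val are functions Loc → ℕ; equations between them are
-- stated pointwise (extensionally).
module _ {nQ nΓ : ℕ} (M : DCPS nQ nΓ) where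

  data Step : Config nQ nΓ → Config nQ nΓ → Set where
    creationStep : ∀ {q γ q' u α w i} {Val Val' : Loc nΓ → ℕ} →
      create q γ q' u α ∈ᴸ Δ M →
      (∀ y → Val' y ≡ Val y + spawn α i y) →
      Step (q , just (γ ∷ w , i) , Val) (q' , just (u ++ w , i) , Val')
    interruptionStep : ∀ {q γ q' u w i} {Val Val' : Loc nΓ → ℕ} →
      interrupt q γ q' u ∈ᴸ Δ M →
      (∀ y → Val' y ≡ Val y + 𝟏 (u ++ w , suc i) y) →
      Step (q , just (γ ∷ w , i) , Val) (q' , nothing , Val')
    resumptionStep : ∀ {q q' γ w i} {Val Val' : Loc nΓ → ℕ} →
      resume q q' γ ∈ᴸ Δ M →
      (∀ y → Val y ≡ Val' y + 𝟏 (γ ∷ w , i) y) →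
      Step (q , nothing , Val) (q' , just (γ ∷ w , i) , Val')

  ActiveAt : ℕ → Config nQ nΓ → Set
  ActiveAt i (_ , η , _) = ∃[ w ] η ≡ just (w , i)

  BStep : ℕ → Config nQ nΓ → Config nQ nΓ → Set
  BStep i c c' = Step c c' × (ActiveAt i c ⊎ ActiveAt i c')

  BSteps : ℕ → Config nQ nΓ → Config nQ nΓ → Set
  BSteps i = Star (BStep i)

  Strat : ℕ → Config nQ nΓ → Set
  Strat zero    c = BSteps 0 (initConfig M) c
  Strat (suc i) c = ∃[ c' ] (Strat i c' × BSteps (suc i) c' c)

  StratifiedReachable : ℕ → Fin nQ → Set
  StratifiedReachable k q =
    ∃[ c ] (Strat k c × proj₁ c ≡ q × proj₁ (proj₂ c) ≡ nothing)

-- Generic pushdown automata (top of stack on the left)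

record PDA : Set₁ where
  field
    State Input Stack : Set
    δ      : State → Stack → Input → State → List Stack → Set
    init   : State
    bottom : Stack
    Final  : State → Set

module _ (P : PDA) where
  open PDA P

  data Run : State × List Stack → List Input → State × List Stack → Set where
    done : ∀ {c} → Run c [] c
    step : ∀ {p γ a p' u w σ c} →
      δ p γ a p' u → Run (p' , u ++ w) σ c → Run (p , γ ∷ w) (a ∷ σ) c

data Dir : Set where
  ▷ ◁ − : Dir

_≟Dir_ : DecidableEquality Dir
▷ ≟Dir ▷ = yes refl
▷ ≟Dir ◁ = no λ ()
▷ ≟Dir − = no λ ()
◁ ≟Dir ▷ = no λ ()
◁ ≟Dir ◁ = yes refl
◁ ≟Dir − = no λ ()
− ≟Dir ▷ = no λ ()
− ≟Dir ◁ = no λ ()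
− ≟Dir − = yes refl

Letter : ℕ → Set
Letter nΓ = Maybe (Fin nΓ) × ℕ × Dir

_≟Letter_ : ∀ {nΓ} → DecidableEquality (Letter nΓ)
_≟Letter_ = ProdP.≡-dec (MaybeP.≡-dec Fin._≟_) (ProdP.≡-dec ℕ._≟_ _≟Dir_)

data InΣ {nΓ : ℕ} (i : ℕ) : Letter nΓ → Set where
  spawnLetter  : (a : Maybe (Fin nΓ)) → InΣ i (a , suc i , ▷)
  resumeLetter : (γ : Fin nΓ) → InΣ i (just γ , i , ◁)
  localLetter  : InΣ i (nothing , i , −)

data PStack (nΓ : ℕ) : Set where
  bot : PStack nΓ
  sym : Maybe (Fin nΓ) → ℕ → PStack nΓ

-- u ∈ Γ_ε is identified with the word 'word u' (ε ↦ [], γ ↦ [γ])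
word : ∀ {nΓ} → Maybe (Fin nΓ) → List (Fin nΓ)
word nothing  = []
word (just γ) = [ γ ]

module _ {nQ nΓ : ℕ} (M : DCPS nQ nΓ) (k : ℕ) where

  data PTrans : Fin nQ → PStack nΓ → Letter nΓ → Fin nQ → List (PStack nΓ) → Set where
    tCreateε : ∀ {i q γ q' u} → i ≤ k →
      create q γ q' (word u) nothing ∈ᴸ Δ M →
      PTrans q (sym (just γ) i) (nothing , i , −) q' [ sym u i ]
    tCreateα : ∀ {i q γ q' u α} → i ≤ k →
      create q γ q' (word u) (just α) ∈ᴸ Δ M →
      PTrans q (sym (just γ) i) (just α , suc i , ▷) q' [ sym u i ]
    tInterrupt : ∀ {i q γ q' u} → i ≤ k →
      interrupt q γ q' (word u) ∈ᴸ Δ M →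
      PTrans q (sym (just γ) i) (u , suc i , ▷) q' [ bot ]
    tResume : ∀ {i q q' γ} → i ≤ k →
      resume q q' γ ∈ᴸ Δ M →
      PTrans q bot (just γ , i , ◁) q' [ sym (just γ) i ]

  𝒫 : Subset nQ → PDA
  𝒫 F = record
    { State  = Fin nQ
    ; Input  = Letter nΓ
    ; Stack  = PStack nΓ
    ; δ      = PTrans
    ; init   = q₀ M
    ; bottom = bot
    ; Final  = λ q → q ∈ F
    }
    where open import Data.Fin.Subset using (_∈_)

count : ∀ {nΓ} → Letter nΓ → List (Letter nΓ) → ℕ
count a σ = length (filter (λ x → x ≟Letter a) σ)

concatUpTo : ∀ {A : Set} → ℕ → (ℕ → List A) → List A
concatUpTo k σ = concat (map σ (upTo (suc k)))

prevWord : ∀ {nQ nΓ} → DCPS nQ nΓ → (ℕ → List (Letter nΓ)) → ℕ → List (Letter nΓ)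
prevWord M σ zero    = [ (just (γ₀ M) , 0 , ▷) ]
prevWord M σ (suc i) = σ i

-- The proof is a simulation between DCFS configurations and configurations
-- of the automaton 𝒫 that share the control state.  The stack of 𝒫 is
-- always a single symbol: ⊥ when no thread is active, (u , i) when the
-- active thread has stack u ∈ Γ_ε and switch number i (relation Corr).
-- Each letter x describes the change of the multiset Val of waiting
-- threads: a ▷-letter adds a thread, a ◁-letter removes one (added/removed,
-- and the relation Effect).  Over a word ρ these changes are summarised by
-- the counts |ρ|_a (relation Balanced), and letters of Σ_i only remove
-- threads of level i and only add threads of level i+1.
module Submission where

open import Defs
open import Data.Nat using (ℕ; zero; suc; _+_; _∸_; _≤_; _<_; _≟_; z≤n; s≤s; z<s)
open import Data.Nat.Properties
open import Algebra.Properties.CommutativeSemigroup +-commutativeSemigroup using () renaming (xy∙z≈xz∙y to +-right-comm)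
open import Data.Fin using (Fin)
open import Data.Fin.Subset using (Subset; _∈_)
open import Data.Maybe using (Maybe; just; nothing)
open import Data.List using (List; []; _∷_; [_]; _++_; length; filter; concat; map; upTo)
import Data.List.Properties as List
open import Data.List.Relation.Unary.All using (All; []; _∷_)
import Data.List.Relation.Unary.All as All
open import Data.List.Membership.Propositional using () renaming (_∈_ to _∈ᴸ_)
open import Data.Product using (_×_; _,_; proj₁; proj₂; ∃-syntax)
open import Data.Sum using (_⊎_; inj₁; inj₂)
open import Data.Empty using (⊥-elim)
open import Relation.Nullary using (yes; no)
open import Relation.Binary.PropositionalEquality as ≡ using (_≡_; _≢_; refl; cong; subst; module ≡-Reasoning)
open import Relation.Binary.Construct.Closure.ReflexiveTransitive using (ε; _◅_)
open import Function.Base using (_∘_)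
open import Function.Bundles using (_⇔_; mk⇔)

module _ {nΓ : ℕ} where

  𝟏-self : (x : Loc nΓ) → 𝟏 x x ≡ 1
  𝟏-self x with x ≟Loc x
  ... | yes _   = refl
  ... | no  x≢x = ⊥-elim (x≢x refl)

  𝟏-other : (x y : Loc nΓ) → x ≢ y → 𝟏 x y ≡ 0
  𝟏-other x y x≢y with x ≟Loc y
  ... | yes x≡y = ⊥-elim (x≢y x≡y)
  ... | no  _   = refl

  𝟏-below : {V : Loc nΓ → ℕ} (x y : Loc nΓ) → 1 ≤ V x → 𝟏 x y ≤ V y
  𝟏-below x y 1≤Vx with x ≟Loc y
  ... | yes refl = 1≤Vx
  ... | no  _    = z≤n

  𝟏≡count : (x y : Loc nΓ) (l a : Letter nΓ) →
    (x ≡ y → l ≡ a) → (l ≡ a → x ≡ y) → 𝟏 x y ≡ count a [ l ]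
  𝟏≡count x y l a to from with x ≟Loc y | l ≟Letter a
  ... | yes _   | yes _   = refl
  ... | no  _   | no  _   = refl
  ... | yes x≡y | no  l≢a = ⊥-elim (l≢a (to x≡y))
  ... | no  x≢y | yes l≡a = ⊥-elim (x≢y (from l≡a))

  count-++ : (a : Letter nΓ) (xs ys : List (Letter nΓ)) →
    count a (xs ++ ys) ≡ count a xs + count a ys
  count-++ a xs ys = ≡.trans (cong length (List.filter-++ (_≟Letter a) xs ys))
                             (List.length-++ (filter (_≟Letter a) xs))

  count-none : (a : Letter nΓ) {ρ : List (Letter nΓ)} → All (_≢ a) ρ → count a ρ ≡ 0
  count-none a avoid = cong length (List.filter-none (_≟Letter a) avoid)

  count-miss : (a l : Letter nΓ) → l ≢ a → count a [ l ] ≡ 0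
  count-miss a l l≢a = count-none a (l≢a ∷ [])

  -- The effect of a letter on the multiset of waiting threads

  added : Letter nΓ → Loc nΓ → ℕ
  added (u , j , ▷) = 𝟏 (word u , j)
  added (u , j , ◁) = λ _ → 0
  added (u , j , −) = λ _ → 0

  removed : Letter nΓ → Loc nΓ → ℕ
  removed (u , j , ▷)        = λ _ → 0
  removed (nothing , j , ◁)  = λ _ → 0
  removed (just γ , j , ◁)   = 𝟏 ([ γ ] , j)
  removed (u , j , −)        = λ _ → 0

  added-count : (x : Letter nΓ) (γ : Fin nΓ) (j : ℕ) → added x ([ γ ] , j) ≡ count (just γ , j , ▷) [ x ]
  added-count x@(nothing , j' , ▷) γ j =
    𝟏≡count ([] , j') ([ γ ] , j) x (just γ , j , ▷) (λ ()) (λ ())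
  added-count x@(just α , j' , ▷) γ j  =
    𝟏≡count ([ α ] , j') ([ γ ] , j) x (just γ , j , ▷) (λ { refl → refl }) (λ { refl → refl })
  added-count x@(u , j' , ◁) γ j       = ≡.sym (count-miss (just γ , j , ▷) x (λ ()))
  added-count x@(u , j' , −) γ j       = ≡.sym (count-miss (just γ , j , ▷) x (λ ()))

  removed-count : (x : Letter nΓ) (γ : Fin nΓ) (j : ℕ) → removed x ([ γ ] , j) ≡ count (just γ , j , ◁) [ x ]
  removed-count x@(u , j' , ▷) γ j       = ≡.sym (count-miss (just γ , j , ◁) x (λ ()))
  removed-count x@(nothing , j' , ◁) γ j = ≡.sym (count-miss (just γ , j , ◁) x (λ ()))
  removed-count x@(just α , j' , ◁) γ j  =
    𝟏≡count ([ α ] , j') ([ γ ] , j) x (just γ , j , ◁) (λ { refl → refl }) (λ { refl → refl })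
  removed-count x@(u , j' , −) γ j       = ≡.sym (count-miss (just γ , j , ◁) x (λ ()))

  record Effect (x : Letter nΓ) (V V' : Loc nΓ → ℕ) : Set where
    constructor effect
    field changes : ∀ y → V' y + removed x y ≡ V y + added x y
  open Effect public

  -- the multiset after x, defined whenever the removed thread is waiting
  after : Letter nΓ → (Loc nΓ → ℕ) → Loc nΓ → ℕ
  after x V y = V y ∸ removed x y + added x y

  after-effect : (x : Letter nΓ) {V : Loc nΓ → ℕ} → (∀ y → removed x y ≤ V y) → Effect x V (after x V)
  after-effect x {V} available = effect λ y → begin
    V y ∸ removed x y + added x y + removed x y  ≡⟨ +-right-comm (V y ∸ removed x y) (added x y) (removed x y) ⟩
    V y ∸ removed x y + removed x y + added x y  ≡⟨ cong (_+ added x y) (m∸n+n≡m (available y)) ⟩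
    V y + added x y                              ∎
    where open ≡-Reasoning

  record Balanced (ρ : List (Letter nΓ)) (V V' : Loc nΓ → ℕ) : Set where
    constructor balanced
    field balance : ∀ γ j → V' ([ γ ] , j) + count (just γ , j , ◁) ρ ≡ V ([ γ ] , j) + count (just γ , j , ▷) ρ
  open Balanced public

  effect⇒balanced : {x : Letter nΓ} {V V' : Loc nΓ → ℕ} → Effect x V V' → Balanced [ x ] V V'
  effect⇒balanced {x} {V} {V'} eff = balanced λ γ j → begin
    V' ([ γ ] , j) + count (just γ , j , ◁) [ x ] ≡⟨ cong (V' _ +_) (≡.sym (removed-count x γ j)) ⟩
    V' ([ γ ] , j) + removed x ([ γ ] , j)        ≡⟨ changes eff ([ γ ] , j) ⟩
    V ([ γ ] , j) + added x ([ γ ] , j)           ≡⟨ cong (V _ +_) (added-count x γ j) ⟩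
    V ([ γ ] , j) + count (just γ , j , ▷) [ x ]  ∎
    where open ≡-Reasoning

  +-balance : ∀ {v₀ v₁ v₂ c₁ c₂ p₁ p₂ : ℕ} →
    v₁ + c₁ ≡ v₀ + p₁ → v₂ + c₂ ≡ v₁ + p₂ → v₂ + (c₁ + c₂) ≡ v₀ + (p₁ + p₂)
  +-balance {v₀} {v₁} {v₂} {c₁} {c₂} {p₁} {p₂} first second = begin
    v₂ + (c₁ + c₂)   ≡⟨ cong (v₂ +_) (+-comm c₁ c₂) ⟩
    v₂ + (c₂ + c₁)   ≡⟨ ≡.sym (+-assoc v₂ c₂ c₁) ⟩
    v₂ + c₂ + c₁     ≡⟨ cong (_+ c₁) second ⟩
    v₁ + p₂ + c₁     ≡⟨ +-right-comm v₁ p₂ c₁ ⟩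
    v₁ + c₁ + p₂     ≡⟨ cong (_+ p₂) first ⟩
    v₀ + p₁ + p₂     ≡⟨ +-assoc v₀ p₁ p₂ ⟩
    v₀ + (p₁ + p₂)   ∎
    where open ≡-Reasoning

  balanced-++ : ∀ {V₀ V₁ V₂ : Loc nΓ → ℕ} ρ₁ ρ₂ →
    Balanced ρ₁ V₀ V₁ → Balanced ρ₂ V₁ V₂ → Balanced (ρ₁ ++ ρ₂) V₀ V₂
  balanced-++ {V₀} {V₁} {V₂} ρ₁ ρ₂ bal₁ bal₂ = balanced λ γ j →
    let resumed ρ = count (just γ , j , ◁) ρ
        spawned ρ = count (just γ , j , ▷) ρ
    in ≡.subst₂ (λ c p → V₂ ([ γ ] , j) + c ≡ V₀ ([ γ ] , j) + p)
         (≡.sym (count-++ (just γ , j , ◁) ρ₁ ρ₂)) (≡.sym (count-++ (just γ , j , ▷) ρ₁ ρ₂))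
         (+-balance {V₀ ([ γ ] , j)} {V₁ ([ γ ] , j)} {V₂ ([ γ ] , j)}
                    {resumed ρ₁} {resumed ρ₂} {spawned ρ₁} {spawned ρ₂}
                    (balance bal₁ γ j) (balance bal₂ γ j))

  -- letters of Σ_i resume only at level i and spawn only at level i+1,
  -- so they are neither spawns at level i nor resumptions at level i+1
  no-spawn-at : ∀ {i γ} {x : Letter nΓ} → InΣ i x → x ≢ (just γ , i , ▷)
  no-spawn-at (spawnLetter a) eq = 1+n≢n (cong (λ x → proj₁ (proj₂ x)) eq)
  no-spawn-at (resumeLetter _) ()
  no-spawn-at localLetter ()

  no-resume-above : ∀ {i γ} {x : Letter nΓ} → InΣ i x → x ≢ (just γ , suc i , ◁)
  no-resume-above (spawnLetter a) ()
  no-resume-above (resumeLetter _) eq = 1+n≢n (≡.sym (cong (λ x → proj₁ (proj₂ x)) eq))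
  no-resume-above localLetter ()

  phase-current : ∀ {i} {ρ : List (Letter nΓ)} {V V'} → All (InΣ i) ρ → Balanced ρ V V' →
    ∀ γ → V' ([ γ ] , i) + count (just γ , i , ◁) ρ ≡ V ([ γ ] , i)
  phase-current ρΣ bal γ = ≡.trans (balance bal γ _)
    (≡.trans (cong (_ +_) (count-none _ (All.map no-spawn-at ρΣ))) (+-identityʳ _))

  phase-next : ∀ {i} {ρ : List (Letter nΓ)} {V V'} → All (InΣ i) ρ → Balanced ρ V V' →
    ∀ γ → V' ([ γ ] , suc i) ≡ V ([ γ ] , suc i) + count (just γ , suc i , ▷) ρ
  phase-next ρΣ bal γ = ≡.trans
    (≡.sym (≡.trans (cong (_ +_) (count-none _ (All.map no-resume-above ρΣ))) (+-identityʳ _)))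
    (balance bal γ _)

module _ (P : PDA) where
  open PDA P

  run-++ : ∀ {c c' c''} xs ys → Run P c xs c' → Run P c' ys c'' → Run P c (xs ++ ys) c''
  run-++ []       ys done       run₂ = run₂
  run-++ (x ∷ xs) ys (step t r) run₂ = step t (run-++ xs ys r run₂)

  run-split : ∀ {c c''} xs ys → Run P c (xs ++ ys) c'' → ∃[ c' ] (Run P c xs c' × Run P c' ys c'')
  run-split []       ys run        = _ , done , run
  run-split (x ∷ xs) ys (step t r) with run-split xs ys r
  ... | c' , run₁ , run₂ = c' , step t run₁ , run₂

concatUpTo-zero : {A : Set} (σ : ℕ → List A) → concatUpTo 0 σ ≡ σ 0
concatUpTo-zero σ = List.++-identityʳ (σ 0)

concatUpTo-suc : {A : Set} (j : ℕ) (σ : ℕ → List A) → concatUpTo (suc j) σ ≡ concatUpTo j σ ++ σ (suc j)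
concatUpTo-suc j σ = begin
  concat (map σ (upTo (suc (suc j))))                   ≡⟨ cong (concat ∘ map σ) (≡.sym (List.upTo-∷ʳ (suc j))) ⟩
  concat (map σ (upTo (suc j) ++ [ suc j ]))            ≡⟨ cong concat (List.map-++ σ (upTo (suc j)) [ suc j ]) ⟩
  concat (map σ (upTo (suc j)) ++ [ σ (suc j) ])        ≡⟨ ≡.sym (List.concat-++ (map σ (upTo (suc j))) [ σ (suc j) ]) ⟩
  concatUpTo j σ ++ (σ (suc j) ++ [])                   ≡⟨ cong (concatUpTo j σ ++_) (List.++-identityʳ (σ (suc j))) ⟩
  concatUpTo j σ ++ σ (suc j)                           ∎
  where open ≡-Reasoning

concatUpTo-cong : {A : Set} (j : ℕ) {σ τ : ℕ → List A} → (∀ n → n ≤ j → σ n ≡ τ n) → concatUpTo j σ ≡ concatUpTo j τ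
concatUpTo-cong zero    {σ} {τ} agree = ≡.trans (concatUpTo-zero σ) (≡.trans (agree 0 z≤n) (≡.sym (concatUpTo-zero τ)))
concatUpTo-cong (suc j) {σ} {τ} agree = ≡.trans (concatUpTo-suc j σ)
  (≡.trans (≡.cong₂ _++_ (concatUpTo-cong j (λ n n≤j → agree n (m≤n⇒m≤1+n n≤j))) (agree (suc j) ≤-refl))
           (≡.sym (concatUpTo-suc j τ)))

_[_≔_] : {A : Set} → (ℕ → A) → ℕ → A → ℕ → A
(σ [ j ≔ a ]) n with n ≟ j
... | yes _ = a
... | no  _ = σ n

≔-hit : {A : Set} (σ : ℕ → A) (j : ℕ) (a : A) → (σ [ j ≔ a ]) j ≡ a
≔-hit σ j a with j ≟ j
... | yes _   = refl
... | no  j≢j = ⊥-elim (j≢j refl)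

≔-miss : {A : Set} (σ : ℕ → A) {j n : ℕ} (a : A) → n ≢ j → (σ [ j ≔ a ]) n ≡ σ n
≔-miss σ {j} {n} a n≢j with n ≟ j
... | yes n≡j = ⊥-elim (n≢j n≡j)
... | no  _   = refl

≔-below : {A : Set} (σ : ℕ → A) {j n : ℕ} (a : A) → n ≤ j → (σ [ suc j ≔ a ]) n ≡ σ n
≔-below σ a n≤j = ≔-miss σ a (λ { refl → 1+n≰n n≤j })

concatUpTo-extend : {A : Set} (j : ℕ) (σ : ℕ → List A) (ρ : List A) →
  concatUpTo (suc j) (σ [ suc j ≔ ρ ]) ≡ concatUpTo j σ ++ ρ
concatUpTo-extend j σ ρ = ≡.trans (concatUpTo-suc j (σ [ suc j ≔ ρ ]))
  (≡.cong₂ _++_ (concatUpTo-cong j (λ n → ≔-below σ ρ)) (≔-hit σ (suc j) ρ))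

module Simulation {nQ nΓ : ℕ} (M : DCPS nQ nΓ) (k : ℕ) (F : Subset nQ) where

  P : PDA
  P = 𝒫 M k F

  Admissible : ℕ → (ℕ → List (Letter nΓ)) → Set
  Admissible j σ = ∀ i → i ≤ j → All (InΣ i) (σ i)
    × (∀ γ → count (just γ , i , ◁) (σ i) ≤ count (just γ , i , ▷) (prevWord M σ i))

  admissible-first : {ρ : List (Letter nΓ)} → All (InΣ 0) ρ →
    (∀ γ → count (just γ , 0 , ◁) ρ ≤ count (just γ , 0 , ▷) [ (just (γ₀ M) , 0 , ▷) ]) →
    Admissible 0 (λ _ → ρ)
  admissible-first ρΣ bounded .0 z≤n = ρΣ , bounded

  admissible-extend : ∀ {j σ} {ρ : List (Letter nΓ)} → Admissible j σ → All (InΣ (suc j)) ρ →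
    (∀ γ → count (just γ , suc j , ◁) ρ ≤ count (just γ , suc j , ▷) (σ j)) →
    Admissible (suc j) (σ [ suc j ≔ ρ ])
  admissible-extend {j} {σ} {ρ} adm ρΣ bounded i i≤1+j with m≤n⇒m<n∨m≡n i≤1+j
  ... | inj₂ refl rewrite ≔-hit σ (suc j) ρ | ≔-below σ ρ (≤-refl {j}) = ρΣ , bounded
  ... | inj₁ i<1+j rewrite ≔-below σ ρ (m<1+n⇒m≤n i<1+j) = proj₁ (adm i i≤j) , earlier
    where
    i≤j : i ≤ j
    i≤j = m<1+n⇒m≤n i<1+j
    previous : ∀ n → n ≤ j → prevWord M (σ [ suc j ≔ ρ ]) n ≡ prevWord M σ n
    previous zero    _     = refl
    previous (suc n) 1+n≤j = ≔-below σ ρ (≤-trans (n≤1+n n) 1+n≤j)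
    earlier : ∀ γ → count (just γ , i , ◁) (σ i) ≤ count (just γ , i , ▷) (prevWord M (σ [ suc j ≔ ρ ]) i)
    earlier γ rewrite previous i i≤j = proj₂ (adm i i≤j) γ

  data Corr : List (PStack nΓ) → Maybe (Loc nΓ) → Set where
    idle        : Corr [ bot ] nothing
    emptyThread : ∀ i → Corr [ sym nothing i ] (just ([] , i))
    thread      : ∀ γ i → Corr [ sym (just γ) i ] (just ([ γ ] , i))

  word-++-[] : (u : Maybe (Fin nΓ)) → word u ++ [] ≡ word u
  word-++-[] nothing  = refl
  word-++-[] (just _) = refl

  corr-word : ∀ u i → Corr [ sym u i ] (just (word u ++ [] , i))
  corr-word nothing  i = emptyThread i
  corr-word (just γ) i = thread γ i

  -- Runs of 𝒫 are realised by stratified executions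

  available : ∀ {i} {x : Letter nΓ} {V : Loc nΓ → ℕ} → InΣ i x →
    (∀ γ → count (just γ , i , ◁) [ x ] ≤ V ([ γ ] , i)) → ∀ y → removed x y ≤ V y
  available (spawnLetter _) _ y = z≤n
  available localLetter     _ y = z≤n
  available {i} {V = V} (resumeLetter γ) enough y = 𝟏-below {V = V} ([ γ ] , i) y
    (subst (_≤ V ([ γ ] , i)) (≡.trans (≡.sym (removed-count (just γ , i , ◁) γ i)) (𝟏-self ([ γ ] , i))) (enough γ))

  realise-step : ∀ {i q t x q' s w η V} → PTrans M k q t x q' s → InΣ i x → Corr (t ∷ w) η →
    (∀ y → removed x y ≤ V y) →
    ∃[ η' ] (BStep M i (q , η , V) (q' , η' , after x V) × Corr (s ++ w) η')
  realise-step (tCreateε {u = u} _ rule) localLetter (thread γ i) _ =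
    _ , (creationStep rule (λ _ → refl) , inj₁ (_ , refl)) , corr-word u i
  realise-step (tCreateα {u = u} _ rule) (spawnLetter _) (thread γ i) _ =
    _ , (creationStep rule (λ _ → refl) , inj₁ (_ , refl)) , corr-word u i
  realise-step {V = V} (tInterrupt {u = u} _ rule) (spawnLetter _) (thread γ i) _ =
    _ , (interruptionStep rule (λ y → cong (λ v → V y + 𝟏 (v , suc i) y) (≡.sym (word-++-[] u))) , inj₁ (_ , refl)) , idle
  realise-step {x = x} {V = V} (tResume {γ = γ} _ rule) (resumeLetter _) idle enough =
    _ , (resumptionStep rule (λ y → ≡.sym (≡.trans (changes (after-effect x enough) y) (+-identityʳ (V y)))) , inj₂ (_ , refl)) ,
    thread γ _

  realise-phase : ∀ {i q s ρ q' s' η V} → Run P (q , s) ρ (q' , s') → All (InΣ i) ρ → Corr s η →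
    (∀ γ → count (just γ , i , ◁) ρ ≤ V ([ γ ] , i)) →
    ∃[ η' ] ∃[ V' ] (BSteps M i (q , η , V) (q' , η' , V') × Corr s' η' × Balanced ρ V V')
  realise-phase done [] corr _ = _ , _ , ε , corr , balanced λ _ _ → refl
  realise-phase {i} {ρ = x ∷ ρ} {V = V} (step t run) (xΣ ∷ ρΣ) corr enough =
    let η₁ , move , corr₁ = realise-step t xΣ corr x-available
        η' , V' , moves , corr' , bal = realise-phase run ρΣ corr₁ enough-for-ρ
    in η' , V' , move ◅ moves , corr' , balanced-++ [ x ] ρ bal₁ bal
    where
    x-available : ∀ y → removed x y ≤ V y
    x-available = available xΣ λ γ →
      ≤-trans (m≤m+n (count (just γ , i , ◁) [ x ]) (count (just γ , i , ◁) ρ))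
        (subst (_≤ V ([ γ ] , i)) (count-++ (just γ , i , ◁) [ x ] ρ) (enough γ))
    bal₁ : Balanced [ x ] V (after x V)
    bal₁ = effect⇒balanced (after-effect x x-available)
    enough-for-ρ : ∀ γ → count (just γ , i , ◁) ρ ≤ after x V ([ γ ] , i)
    enough-for-ρ γ = +-cancelˡ-≤ (count (just γ , i , ◁) [ x ]) _ _ (begin
      count (just γ , i , ◁) [ x ] + count (just γ , i , ◁) ρ ≡⟨ ≡.sym (count-++ (just γ , i , ◁) [ x ] ρ) ⟩
      count (just γ , i , ◁) (x ∷ ρ)                            ≤⟨ enough γ ⟩
      V ([ γ ] , i)                                             ≡⟨ ≡.sym (phase-current (xΣ ∷ []) bal₁ γ) ⟩
      after x V ([ γ ] , i) + count (just γ , i , ◁) [ x ]      ≡⟨ +-comm (after x V ([ γ ] , i)) _ ⟩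
      count (just γ , i , ◁) [ x ] + after x V ([ γ ] , i)      ∎)
      where open ≤-Reasoning

  spawned-waiting : ∀ {i} {ρ : List (Letter nΓ)} {V V'} → All (InΣ i) ρ → Balanced ρ V V' →
    ∀ γ → count (just γ , suc i , ▷) ρ ≤ V' ([ γ ] , suc i)
  spawned-waiting ρΣ bal γ = subst (_ ≤_) (≡.sym (phase-next ρΣ bal γ)) (m≤n+m _ _)

  realise-prefix : ∀ {σ} → Admissible k σ → ∀ j → j ≤ k → ∀ {q s} →
    Run P (q₀ M , [ bot ]) (concatUpTo j σ) (q , s) →
    ∃[ η ] ∃[ V ] (Strat M j (q , η , V) × Corr s η × (∀ γ → count (just γ , suc j , ▷) (σ j) ≤ V ([ γ ] , suc j)))
  realise-prefix {σ} adm zero _ run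
    with realise-phase (subst (λ ρ → Run P _ ρ _) (concatUpTo-zero σ) run) (proj₁ (adm 0 z≤n)) idle
           (λ γ → ≤-trans (proj₂ (adm 0 z≤n) γ) (≤-reflexive (≡.sym (added-count (just (γ₀ M) , 0 , ▷) γ 0))))
  ... | η , V , moves , corr , bal = η , V , moves , corr , spawned-waiting (proj₁ (adm 0 z≤n)) bal
  realise-prefix {σ} adm (suc j) 1+j≤k run
    with run-split P (concatUpTo j σ) (σ (suc j)) (subst (λ ρ → Run P _ ρ _) (concatUpTo-suc j σ) run)
  ... | (q₁ , s₁) , run₁ , run₂ with realise-prefix adm j (<⇒≤ 1+j≤k) run₁
  ... | η₁ , V₁ , strat₁ , corr₁ , waiting₁
    with realise-phase run₂ (proj₁ (adm (suc j) 1+j≤k)) corr₁ (λ γ → ≤-trans (proj₂ (adm (suc j) 1+j≤k) γ) (waiting₁ γ))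
  ... | η , V , moves , corr , bal =
    η , V , ((q₁ , η₁ , V₁) , strat₁ , moves) , corr , spawned-waiting (proj₁ (adm (suc j) 1+j≤k)) bal

  -- Stratified executions of a DCFS are reflected by runs of 𝒫

  -- waiting threads that cannot occur in phase i of a DCFS execution
  data Negligible (i : ℕ) : Loc nΓ → Set where
    long : ∀ γ₁ γ₂ w j → Negligible i (γ₁ ∷ γ₂ ∷ w , j)
    high : ∀ w j → suc i < j → Negligible i (w , j)

  Tidy : ℕ → (Loc nΓ → ℕ) → Set
  Tidy i V = ∀ {y} → Negligible i y → V y ≡ 0

  tidy-init : Tidy 0 (𝟏 ([ γ₀ M ] , 0))
  tidy-init (long γ₁ γ₂ w j) = 𝟏-other _ (γ₁ ∷ γ₂ ∷ w , j) (λ ())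
  tidy-init (high w j 1<j)   = 𝟏-other _ (w , j) (λ eq → <-irrefl (cong proj₂ eq) (<-trans z<s 1<j))

  tidy-next : ∀ {i V} → Tidy i V → Tidy (suc i) V
  tidy-next tidy (long γ₁ γ₂ w j) = tidy (long γ₁ γ₂ w j)
  tidy-next tidy (high w j 2+i<j) = tidy (high w j (<-trans (n<1+n _) 2+i<j))

  tidy-fresh : ∀ {i V} → Tidy i V → ∀ γ → V ([ γ ] , suc (suc i)) ≡ 0
  tidy-fresh tidy γ = tidy (high [ γ ] _ (n<1+n _))

  added-negligible : ∀ {i x y} → InΣ i x → Negligible i y → added x y ≡ 0
  added-negligible {i} (spawnLetter nothing)  (long γ₁ γ₂ w j) = 𝟏-other ([] , suc i) (γ₁ ∷ γ₂ ∷ w , j) (λ ())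
  added-negligible {i} (spawnLetter (just γ)) (long γ₁ γ₂ w j) = 𝟏-other ([ γ ] , suc i) (γ₁ ∷ γ₂ ∷ w , j) (λ ())
  added-negligible {i} (spawnLetter u) (high w j 1+i<j)        = 𝟏-other (word u , suc i) (w , j) (λ eq → <-irrefl (cong proj₂ eq) 1+i<j)
  added-negligible (resumeLetter _) _ = refl
  added-negligible localLetter      _ = refl

  tidy-step : ∀ {i x V V'} → InΣ i x → Effect x V V' → Tidy i V → Tidy i V'
  tidy-step {x = x} {V} {V'} xΣ eff tidy {y} negl = m+n≡0⇒m≡0 (V' y) (begin
    V' y + removed x y  ≡⟨ changes eff y ⟩
    V y + added x y     ≡⟨ ≡.cong₂ _+_ (tidy negl) (added-negligible xΣ negl) ⟩
    0                   ∎)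
    where open ≡-Reasoning

  data IsWord : List (Fin nΓ) → Set where
    isWord : (u : Maybe (Fin nΓ)) → IsWord (word u)

  short-word : (u : List (Fin nΓ)) → length u ≤ 1 → IsWord u
  short-word []            _        = isWord nothing
  short-word (γ ∷ [])      _        = isWord (just γ)
  short-word (_ ∷ _ ∷ _)   (s≤s ())

  reflect-creation : IsDCFS M → ∀ {i q γ q' u α V V'} → i ≤ k →
    create q γ q' u α ∈ᴸ Δ M → (∀ y → V' y ≡ V y + spawn α i y) →
    ∃[ x ] ∃[ s' ] (InΣ i x × Run P (q , [ sym (just γ) i ]) [ x ] (q' , s') × Corr s' (just (u ++ [] , i))
      × Effect x V V')
  reflect-creation dcfs {u = u} i≤k rule eq with short-word u (All.lookup dcfs rule)
  reflect-creation dcfs {α = nothing} i≤k rule eq | isWord u =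
    _ , _ , localLetter , step (tCreateε i≤k rule) done , corr-word u _ , effect λ y → ≡.trans (+-identityʳ _) (eq y)
  reflect-creation dcfs {α = just a} i≤k rule eq | isWord u =
    _ , _ , spawnLetter (just a) , step (tCreateα i≤k rule) done , corr-word u _ ,
    effect λ y → ≡.trans (+-identityʳ _) (eq y)

  -- an {i}-bounded step of a tidy execution is one transition of 𝒫 over Σ_i;
  -- the DCFS condition keeps new threads short, tidiness the resumed one
  reflect-step : IsDCFS M → ∀ {i q η V q' η' V' s} → i ≤ k → BStep M i (q , η , V) (q' , η' , V') →
    Corr s η → Tidy i V →
    ∃[ x ] ∃[ s' ] (InΣ i x × Run P (q , s) [ x ] (q' , s') × Corr s' η' × Effect x V V')
  reflect-step dcfs i≤k (creationStep rule eq , inj₁ (_ , refl)) (thread γ i) _ = reflect-creation dcfs i≤k rule eq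
  reflect-step dcfs i≤k (creationStep rule eq , inj₂ (_ , refl)) (thread γ i) _ = reflect-creation dcfs i≤k rule eq
  reflect-step dcfs i≤k (interruptionStep {u = w} {Val = V} rule eq , inj₁ (_ , refl)) (thread γ i) _
    with short-word w (All.lookup dcfs rule)
  ... | isWord u = _ , _ , spawnLetter u , step (tInterrupt i≤k rule) done , idle ,
    effect λ y → ≡.trans (+-identityʳ _) (≡.trans (eq y) (cong (λ v → V y + 𝟏 (v , suc i) y) (word-++-[] u)))
  reflect-step dcfs i≤k (interruptionStep rule eq , inj₂ (_ , ())) _ _
  reflect-step dcfs i≤k (resumptionStep rule eq , inj₁ (_ , ())) _ _
  reflect-step dcfs i≤k (resumptionStep {γ = γ} {w = []} {Val' = V'} rule eq , inj₂ (_ , refl)) idle _ =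
    _ , _ , resumeLetter γ , step (tResume i≤k rule) done , thread γ _ ,
    effect λ y → ≡.trans (≡.sym (eq y)) (≡.sym (+-identityʳ _))
  reflect-step dcfs i≤k (resumptionStep {γ = γ} {w = γ₂ ∷ w} {i = i} {Val' = V'} rule eq , inj₂ (_ , refl)) idle tidy
    with m+n≡0⇒n≡0 (V' _) (≡.sym (≡.trans (≡.sym (tidy (long γ γ₂ w i)))
                                  (≡.trans (eq _) (cong (V' _ +_) (𝟏-self (γ ∷ γ₂ ∷ w , i))))))
  ... | ()

  reflect-phase : IsDCFS M → ∀ {i q η V q' η' V' s} → i ≤ k → BSteps M i (q , η , V) (q' , η' , V') →
    Corr s η → Tidy i V →
    ∃[ ρ ] ∃[ s' ] (All (InΣ i) ρ × Run P (q , s) ρ (q' , s') × Corr s' η' × Tidy i V' × Balanced ρ V V')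
  reflect-phase dcfs i≤k ε corr tidy = [] , _ , [] , done , corr , tidy , balanced λ _ _ → refl
  reflect-phase dcfs i≤k (move ◅ moves) corr tidy with reflect-step dcfs i≤k move corr tidy
  ... | x , s₁ , xΣ , run₁ , corr₁ , eff with reflect-phase dcfs i≤k moves corr₁ (tidy-step xΣ eff tidy)
  ... | ρ , s' , ρΣ , run , corr' , tidy' , bal =
    x ∷ ρ , s' , xΣ ∷ ρΣ , run-++ P [ x ] ρ run₁ run , corr' , tidy' , balanced-++ [ x ] ρ (effect⇒balanced eff) bal

  reflect-prefix : IsDCFS M → ∀ j → j ≤ k → ∀ {q η V} → Strat M j (q , η , V) →
    ∃[ σ ] ∃[ s ] (Admissible j σ × Run P (q₀ M , [ bot ]) (concatUpTo j σ) (q , s) × Corr s η × Tidy j V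
      × (∀ γ → V ([ γ ] , suc j) ≡ count (just γ , suc j , ▷) (σ j)))
  reflect-prefix dcfs zero _ moves with reflect-phase dcfs z≤n moves idle tidy-init
  ... | ρ , s , ρΣ , run , corr , tidy , bal =
    (λ _ → ρ) , s ,
    admissible-first ρΣ (λ γ → ≤-trans (m≤n+m _ _)
      (≤-reflexive (≡.trans (phase-current ρΣ bal γ) (added-count (just (γ₀ M) , 0 , ▷) γ 0)))) ,
    subst (λ ρ' → Run P _ ρ' _) (≡.sym (concatUpTo-zero (λ _ → ρ))) run , corr , tidy ,
    λ γ → ≡.trans (phase-next ρΣ bal γ) (cong (_+ count (just γ , 1 , ▷) ρ) (𝟏-other ([ γ₀ M ] , 0) ([ γ ] , 1) (λ ())))
  reflect-prefix dcfs (suc j) 1+j≤k ((_ , _ , V₁) , strat₁ , moves)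
    with reflect-prefix dcfs j (<⇒≤ 1+j≤k) strat₁
  ... | σ , s₁ , adm , run₁ , corr₁ , tidy₁ , waiting₁
    with reflect-phase dcfs 1+j≤k moves corr₁ (tidy-next tidy₁)
  ... | ρ , s , ρΣ , run₂ , corr , tidy , bal =
    σ [ suc j ≔ ρ ] , s ,
    admissible-extend adm ρΣ (λ γ → ≤-trans (m≤n+m _ _)
      (≤-reflexive (≡.trans (phase-current ρΣ bal γ) (waiting₁ γ)))) ,
    subst (λ ρ' → Run P _ ρ' _) (≡.sym (concatUpTo-extend j σ ρ)) (run-++ P (concatUpTo j σ) ρ run₁ run₂) ,
    corr , tidy ,
    λ γ → ≡.trans (phase-next ρΣ bal γ)
      (≡.trans (cong (_+ _) (tidy-fresh tidy₁ γ)) (cong (count _) (≡.sym (≔-hit σ (suc j) ρ))))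

  ReachesFinal : Set
  ReachesFinal = ∃[ q ] (q ∈ F × StratifiedReachable M k q)

  AcceptsAdmissibly : Set
  AcceptsAdmissibly = ∃[ σ ] (
      (∀ i → i ≤ k → All (InΣ i) (σ i))
    × (∃[ qf ] (qf ∈ F × Run P (q₀ M , [ bot ]) (concatUpTo k σ) (qf , [ bot ])))
    × (∀ (γ : Fin nΓ) i → i ≤ k → count (just γ , i , ◁) (σ i) ≤ count (just γ , i , ▷) (prevWord M σ i)))

  -- a final configuration has no active thread, so its stack is ⊥
  reaches⇒accepts : IsDCFS M → ReachesFinal → AcceptsAdmissibly
  reaches⇒accepts dcfs (q , q∈F , (_ , _ , _) , strat , refl , refl) with reflect-prefix dcfs k ≤-refl strat
  ... | σ , _ , adm , run , idle , _ =
    σ , (λ i i≤k → proj₁ (adm i i≤k)) , (q , q∈F , run) , (λ γ i i≤k → proj₂ (adm i i≤k) γ)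

  -- an accepting run ends with ⊥, so the execution has no active thread
  accepts⇒reaches : AcceptsAdmissibly → ReachesFinal
  accepts⇒reaches (σ , σΣ , (qf , qf∈F , run) , bounded)
    with realise-prefix (λ i i≤k → σΣ i i≤k , λ γ → bounded γ i i≤k) k ≤-refl run
  ... | _ , V , strat , idle , _ = qf , qf∈F , (qf , nothing , V) , strat , refl , refl

lemma4p4 : (nQ nΓ : ℕ) (M : DCPS nQ nΓ) → IsDCFS M → (k : ℕ) → (F : Subset nQ) →
    (∃[ q ] (q ∈ F × StratifiedReachable M k q))
      ⇔
    (∃[ σ ] (
        (∀ i → i ≤ k → All (InΣ i) (σ i))
      × (∃[ qf ] (qf ∈ F × Run (𝒫 M k F) (q₀ M , [ bot ]) (concatUpTo k σ) (qf , [ bot ])))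
      × (∀ (γ : Fin nΓ) i → i ≤ k →
           count (just γ , i , ◁) (σ i) ≤ count (just γ , i , ▷) (prevWord M σ i))))
lemma4p4 nQ nΓ M dcfs k F = mk⇔ (reaches⇒accepts dcfs) accepts⇒reaches
  where open Simulation M k F
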